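{- Let $G$ be a finite simple graph and $H$ a subgraph of $G$ such that $\alpha(G)=\alpha(H)+\alpha(G-H)$. If $G$ is $\alpha^{++}$-stable, then $H$ is $\alpha^{++}$-stable.
   Context: $\alpha(G)$ is the maximum size of a stable set. $G-H$ denotes the subgraph of $G$ induced by $V(G)-V(H)$. For $e\in E(\overline{G})$ (a pair of distinct non-adjacent vertices), $G+e$ denotes $G$ with $e$ added. $G$ is $\alpha^{++}$-stable if $\alpha(G+e_1+e_2)=\alpha(G)$ for any $e_1,e_2\in E(\overline{G})$ (not necessarily distinct). -}

module Defs where

open import Data.Nat using (ℕ; zero; suc; _⊔_)
open import Data.Bool using (Bool; true; false; _∧_; _∨_; not; if_then_else_)
open import Data.Fin using (Fin; _≟_)
open import Data.Fin.Subset using (Subset; inside; outside; ∣_∣)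
open import Data.Vec using (Vec; []; _∷_; lookup)
open import Data.List using (List; []; _∷_; _++_; map; foldr)
open import Data.Bool.ListAction using (all)
open import Data.List using () renaming (allFin to allFinL)
open import Data.Product using (_×_)
open import Relation.Binary.PropositionalEquality using (_≡_)
open import Relation.Nullary using (¬_)
open import Relation.Nullary.Decidable using (⌊_⌋)

record Graph (n : ℕ) : Set where
  constructor graph
  field
    V   : Subset n
    adj : Fin n → Fin n → Bool
open Graph public

record Simple {n : ℕ} (G : Graph n) : Set where
  field
    symm   : ∀ u v → adj G u v ≡ adj G v u
    irrefl : ∀ v → adj G v v ≡ false
    closed : ∀ u v → adj G u v ≡ true → (lookup (V G) u ≡ true) × (lookup (V G) v ≡ true)

record Subgraph {n : ℕ} (H G : Graph n) : Set where
  field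
    vsub : ∀ v → lookup (V H) v ≡ true → lookup (V G) v ≡ true
    esub : ∀ u v → adj H u v ≡ true → adj G u v ≡ true

-- G - H : subgraph of G induced by V(G) - V(H).
_minus_ : ∀ {n} → Graph n → Graph n → Graph n
_minus_ {n} G H = graph W (λ u v → adj G u v ∧ lookup W u ∧ lookup W v)
  where
  W : Subset n
  W = Data.Vec.zipWith (λ a b → a ∧ not b) (V G) (V H)

NonEdge : ∀ {n} → Graph n → Fin n → Fin n → Set
NonEdge G u v = (¬ u ≡ v) × (lookup (V G) u ≡ true) × (lookup (V G) v ≡ true) × (adj G u v ≡ false)

addEdge : ∀ {n} → Graph n → Fin n → Fin n → Graph n
addEdge G u v = graph (V G) (λ x y → adj G x y ∨ (⌊ x ≟ u ⌋ ∧ ⌊ y ≟ v ⌋) ∨ (⌊ x ≟ v ⌋ ∧ ⌊ y ≟ u ⌋))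

subsets : ∀ n → List (Subset n)
subsets zero = [] ∷ []
subsets (suc n) = map (inside ∷_) (subsets n) ++ map (outside ∷_) (subsets n)

isStable : ∀ {n} → Graph n → Subset n → Bool
isStable {n} G S =
  all (λ u → not (lookup S u) ∨ (lookup (V G) u ∧ all (λ v → not (lookup S v) ∨ not (adj G u v)) (allFinL n))) (allFinL n)

α : ∀ {n} → Graph n → ℕ
α {n} G = foldr (λ S m → if isStable G S then ∣ S ∣ ⊔ m else m) 0 (subsets n)

α⁺⁺-stable : ∀ {n} → Graph n → Set
α⁺⁺-stable G = ∀ u₁ v₁ u₂ v₂ → NonEdge G u₁ v₁ → NonEdge G u₂ v₂ →
  α (addEdge (addEdge G u₁ v₁) u₂ v₂) ≡ α G

{-# OPTIONS --safe #-}
-- Let e₁, e₂ be non-edges of H. Adding edges can only shrink α, so α(H + e₁ + e₂) ≤ α(H).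
-- Conversely, e₁ and e₂ join distinct vertices of G; those already adjacent in G change
-- nothing, so α⁺⁺-stability of G gives α(G + e₁ + e₂) = α(G). Splitting a stable set of
-- G + e₁ + e₂ along V(H) gives α(G + e₁ + e₂) ≤ α(H + e₁ + e₂) + α(G − H), and comparing with
-- α(G) = α(H) + α(G − H) yields α(H) ≤ α(H + e₁ + e₂).
module Submission where

open import Defs
open import Data.Nat using (ℕ; suc; _+_; _≤_; _⊔_; z≤n)
open import Data.Nat.Properties
  using (≤-refl; ≤-trans; ≤-reflexive; ≤-antisym; m≤m⊔n; m≤n⊔m; ⊔-lub; +-mono-≤; +-monoʳ-≤; +-suc; +-cancelʳ-≤;
         module ≤-Reasoning)
open import Data.Bool using (Bool; true; false; _∧_; _∨_; not; if_then_else_)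
open import Data.Bool.Properties using (∧-conicalˡ; not-injective; not-¬; ¬-not; T-≡)
open import Data.Bool.ListAction using (all)
open import Data.Fin using (Fin; _≟_)
open import Data.Fin.Subset using (Subset; inside; outside; ∣_∣; _∩_; ∁; _∈_; _∉_; _⊆_)
open import Data.Fin.Subset.Properties using (x∈p∩q⁻; x∈∁p⇒x∉p)
open import Data.Vec using ([]; _∷_; lookup)
open import Data.Vec.Properties using (lookup-zipWith; []=⇒lookup; lookup⇒[]=)
open import Data.List using (List; []; _∷_; map; foldr; allFin)
open import Data.List.Membership.Propositional using () renaming (_∈_ to _∈ˡ_)
open import Data.List.Membership.Propositional.Properties using (∈-map⁺; ∈-++⁺ˡ; ∈-++⁺ʳ; ∈-allFin)
open import Data.List.Relation.Unary.Any using (here; there)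
import Data.List.Relation.Unary.All as All
open import Data.List.Relation.Unary.All.Properties using (all⁺; all⁻)
open import Data.Product using (_×_; _,_; proj₁; proj₂)
open import Data.Product.Function.NonDependent.Propositional using (_×-⇔_)
open import Data.Sum using (_⊎_; inj₁; inj₂)
open import Data.Sum.Function.Propositional using (_⊎-⇔_)
open import Function using (id; _∘_; _$_; case_of_)
open import Function.Bundles using (_⇔_; mk⇔; module Equivalence)
open import Function.Construct.Composition using (_⇔-∘_)
open import Function.Construct.Identity using (⇔-id)
open import Relation.Nullary using (¬_)
open import Relation.Nullary.Decidable using (⌊_⌋; toWitness; fromWitness)
open import Relation.Binary.PropositionalEquality using (_≡_; refl; sym; trans; cong)

open Equivalence using (to; from)

private
  variable
    n : ℕ
    a b : Bool
    u v : Fin n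
    G H K K′ : Graph n
    S W : Subset n

∧≡true⇔ : a ∧ b ≡ true ⇔ (a ≡ true × b ≡ true)
∧≡true⇔ {true}  = mk⇔ (refl ,_) proj₂
∧≡true⇔ {false} = mk⇔ (λ ()) (λ ())

∨≡true⇔ : a ∨ b ≡ true ⇔ (a ≡ true ⊎ b ≡ true)
∨≡true⇔ {true}  = mk⇔ inj₁ (λ _ → refl)
∨≡true⇔ {false} = mk⇔ inj₂ (λ { (inj₁ ()) ; (inj₂ b≡true) → b≡true })

not∨≡true⇔ : not a ∨ b ≡ true ⇔ (a ≡ true → b ≡ true)
not∨≡true⇔ {true}  = mk⇔ (λ b≡true _ → b≡true) (λ f → f refl)
not∨≡true⇔ {false} = mk⇔ (λ _ ()) (λ _ → refl)

all-allFin⇔ : ∀ {n} (p : Fin n → Bool) → all p (allFin n) ≡ true ⇔ (∀ i → p i ≡ true)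
all-allFin⇔ {n} p = mk⇔
  (λ h i → T-≡ .to (All.lookup (all⁺ p _ (T-≡ .from h)) (∈-allFin i)))
  (λ f → T-≡ .to (all⁻ p {xs = allFin n} (All.tabulate λ {i} _ → T-≡ .from (f i))))

maxWhere : {A : Set} → (A → Bool) → (A → ℕ) → List A → ℕ
maxWhere p f = foldr (λ x m → if p x then f x ⊔ m else m) 0

module _ {A : Set} (p : A → Bool) (f : A → ℕ) where

  maxWhere-upperBound : ∀ {x xs} → x ∈ˡ xs → p x ≡ true → f x ≤ maxWhere p f xs
  maxWhere-upperBound {xs = y ∷ ys} (here refl) px rewrite px = m≤m⊔n _ _
  maxWhere-upperBound {xs = y ∷ ys} (there x∈ys) px with p y
  ... | true  = ≤-trans (maxWhere-upperBound x∈ys px) (m≤n⊔m _ _)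
  ... | false = maxWhere-upperBound x∈ys px

  maxWhere-least : ∀ {k} xs → (∀ x → p x ≡ true → f x ≤ k) → maxWhere p f xs ≤ k
  maxWhere-least []       _     = z≤n
  maxWhere-least (y ∷ ys) bound with p y in py
  ... | true  = ⊔-lub (bound y py) (maxWhere-least ys bound)
  ... | false = maxWhere-least ys bound

∈-subsets : (S : Subset n) → S ∈ˡ subsets n
∈-subsets []                = here refl
∈-subsets {suc n} (true ∷ S)  = ∈-++⁺ˡ (∈-map⁺ (inside ∷_) (∈-subsets S))
∈-subsets {suc n} (false ∷ S) = ∈-++⁺ʳ (map (inside ∷_) (subsets n)) (∈-map⁺ (outside ∷_) (∈-subsets S))

∈⇔lookup≡true : u ∈ S ⇔ lookup S u ≡ true
∈⇔lookup≡true = mk⇔ []=⇒lookup (lookup⇒[]= _ _)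

record IsStableSet (G : Graph n) (S : Subset n) : Set where
  field
    ⊆V          : S ⊆ V G
    independent : ∀ {u v} → u ∈ S → v ∈ S → adj G u v ≡ false
open IsStableSet

isStable⇔IsStableSet : isStable G S ≡ true ⇔ IsStableSet G S
isStable⇔IsStableSet {n} {G} {S} = mk⇔ sound complete
  where
  nonadjacent : Fin n → Fin n → Bool
  nonadjacent u v = not (lookup S v) ∨ not (adj G u v)

  row : Fin n → Bool
  row u = lookup (V G) u ∧ all (nonadjacent u) (allFin n)

  row≡true : isStable G S ≡ true → u ∈ S → row u ≡ true
  row≡true {u} h u∈S = not∨≡true⇔ .to (all-allFin⇔ _ .to h u) (∈⇔lookup≡true .to u∈S)

  sound : isStable G S ≡ true → IsStableSet G S
  sound h .⊆V u∈S = ∈⇔lookup≡true .from (proj₁ (∧≡true⇔ .to (row≡true h u∈S)))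
  sound h .independent {v = v} u∈S v∈S = not-injective (not∨≡true⇔ .to
    (all-allFin⇔ _ .to (proj₂ (∧≡true⇔ .to (row≡true h u∈S))) v) (∈⇔lookup≡true .to v∈S))

  complete : IsStableSet G S → isStable G S ≡ true
  complete st =
    all-allFin⇔ (λ u → not (lookup S u) ∨ row u) .from λ u → not∨≡true⇔ .from λ Su →
      ∧≡true⇔ .from (∈⇔lookup≡true .to (st .⊆V (∈⇔lookup≡true .from Su)) ,
        all-allFin⇔ (nonadjacent u) .from λ v → not∨≡true⇔ .from λ Sv →
          cong not (st .independent (∈⇔lookup≡true .from Su) (∈⇔lookup≡true .from Sv)))

stable⇒∣S∣≤α : IsStableSet G S → ∣ S ∣ ≤ α G
stable⇒∣S∣≤α {G = G} {S} st =
  maxWhere-upperBound (isStable G) ∣_∣ (∈-subsets S) (isStable⇔IsStableSet .from st)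

α-lub : ∀ {k} → (∀ S → IsStableSet G S → ∣ S ∣ ≤ k) → α G ≤ k
α-lub {n} {G} bound =
  maxWhere-least (isStable G) ∣_∣ (subsets n) λ S h → bound S (isStable⇔IsStableSet .to h)

-- _⊑_ and Adjacent are records, not Π/Σ-types, so that Agda can infer the graphs from them.
infix 4 _⊑_

record _⊑_ (G K : Graph n) : Set where
  constructor mk⊑
  field adj-mono : ∀ {u v} → adj G u v ≡ true → adj K u v ≡ true
open _⊑_

⊑-refl : G ⊑ G
⊑-refl = mk⊑ id

⊑-trans : G ⊑ H → H ⊑ K → G ⊑ K
⊑-trans G⊑H H⊑K = mk⊑ (H⊑K .adj-mono ∘ G⊑H .adj-mono)

⊑⇒nonadjacent : G ⊑ K → adj K u v ≡ false → adj G u v ≡ false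
⊑⇒nonadjacent G⊑K ¬uv = ¬-not λ uv → not-¬ (G⊑K .adj-mono uv) ¬uv

stable-restrict : H ⊑ G → IsStableSet G S → W ⊆ S → W ⊆ V H → IsStableSet H W
stable-restrict H⊑G st W⊆S W⊆V .⊆V = W⊆V
stable-restrict H⊑G st W⊆S W⊆V .independent u∈W v∈W =
  ⊑⇒nonadjacent H⊑G (st .independent (W⊆S u∈W) (W⊆S v∈W))

α-antitone : V K ⊆ V G → G ⊑ K → α K ≤ α G
α-antitone VK⊆VG G⊑K =
  α-lub λ S st → stable⇒∣S∣≤α (stable-restrict G⊑K st id (VK⊆VG ∘ st .⊆V))

⌊≟⌋≡true⇔ : {x y : Fin n} → ⌊ x ≟ y ⌋ ≡ true ⇔ x ≡ y
⌊≟⌋≡true⇔ = mk⇔ (toWitness ∘ T-≡ .from) (T-≡ .to ∘ fromWitness)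

adj-addEdge⇔ : (K : Graph n) (u v : Fin n) {x y : Fin n} → adj (addEdge K u v) x y ≡ true ⇔
               (adj K x y ≡ true ⊎ (x ≡ u × y ≡ v) ⊎ (x ≡ v × y ≡ u))
adj-addEdge⇔ K u v {x} =
  (⇔-id _ ⊎-⇔ (both ⊎-⇔ both) ⇔-∘ ∨≡true⇔) ⇔-∘ ∨≡true⇔ {adj K x _}
  where
  both : ∀ {a b c d : Fin _} → ⌊ a ≟ b ⌋ ∧ ⌊ c ≟ d ⌋ ≡ true ⇔ (a ≡ b × c ≡ d)
  both = (⌊≟⌋≡true⇔ ×-⇔ ⌊≟⌋≡true⇔) ⇔-∘ ∧≡true⇔

record Adjacent (K : Graph n) (u v : Fin n) : Set where
  constructor _,_
  field
    adjᵘᵛ : adj K u v ≡ true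
    adjᵛᵘ : adj K v u ≡ true

Adjacent-mono : K ⊑ K′ → Adjacent K u v → Adjacent K′ u v
Adjacent-mono K⊑K′ (uv , vu) = K⊑K′ .adj-mono uv , K⊑K′ .adj-mono vu

⊑-addEdge : K ⊑ addEdge K u v
⊑-addEdge {K = K} {u} {v} = mk⊑ (adj-addEdge⇔ K u v .from ∘ inj₁)

⊑-addEdge₂ : ∀ {u₁ v₁ u₂ v₂} → K ⊑ addEdge (addEdge K u₁ v₁) u₂ v₂
⊑-addEdge₂ = ⊑-trans ⊑-addEdge ⊑-addEdge

addEdge-adjacent : Adjacent (addEdge K u v) u v
addEdge-adjacent {K = K} {u} {v} =
  adj-addEdge⇔ K u v .from (inj₂ (inj₁ (refl , refl))) ,
  adj-addEdge⇔ K u v .from (inj₂ (inj₂ (refl , refl)))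

addEdge-least : K ⊑ K′ → Adjacent K′ u v → addEdge K u v ⊑ K′
addEdge-least {K = K} {u = u} {v} K⊑K′ (uv , vu) =
  mk⊑ λ xy → case adj-addEdge⇔ K u v .to xy of λ where
    (inj₁ xy)                   → K⊑K′ .adj-mono xy
    (inj₂ (inj₁ (refl , refl))) → uv
    (inj₂ (inj₂ (refl , refl))) → vu

addEdge-mono : K ⊑ K′ → addEdge K u v ⊑ addEdge K′ u v
addEdge-mono {K′ = K′} {u = u} {v} K⊑K′ =
  addEdge-least (⊑-trans K⊑K′ ⊑-addEdge) (addEdge-adjacent {K = K′} {u} {v})

VertexPair : Graph n → Fin n → Fin n → Set
VertexPair G u v = (¬ u ≡ v) × (lookup (V G) u ≡ true) × (lookup (V G) v ≡ true)

nonEdge⇒vertexPair : Subgraph H G → NonEdge H u v → VertexPair G u v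
nonEdge⇒vertexPair sg (u≢v , u∈VH , v∈VH , _) =
  u≢v , Subgraph.vsub sg _ u∈VH , Subgraph.vsub sg _ v∈VH

nonEdge-or-adjacent : Simple G → VertexPair G u v → NonEdge G u v ⊎ Adjacent G u v
nonEdge-or-adjacent {G = G} {u} {v} sG (u≢v , u∈VG , v∈VG) with adj G u v in uv
... | false = inj₁ (u≢v , u∈VG , v∈VG , refl)
... | true  = inj₂ (uv , trans (Simple.symm sG v u) uv)

α≤α-addEdge : α⁺⁺-stable G → NonEdge G u v → α G ≤ α (addEdge G u v)
-- α⁺⁺-stability for e₁ = e₂ = e, since G + e ⊑ G + e + e.
α≤α-addEdge {G = G} {u} {v} stG uv =
  ≤-trans (≤-reflexive (sym (stG u v u v uv uv))) (α-antitone id (⊑-addEdge {K = addEdge G u v} {u} {v}))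

α⁺⁺-stable-vertexPairs : ∀ {u₁ v₁ u₂ v₂} → Simple G → α⁺⁺-stable G →
  VertexPair G u₁ v₁ → VertexPair G u₂ v₂ → α (addEdge (addEdge G u₁ v₁) u₂ v₂) ≡ α G
α⁺⁺-stable-vertexPairs {G = G} {u₁} {v₁} {u₂} {v₂} sG stG p₁ p₂ =
  ≤-antisym (α-antitone id G⊑G′)
            (lower (nonEdge-or-adjacent sG p₁) (nonEdge-or-adjacent sG p₂))
  where
  G′ : Graph _
  G′ = addEdge (addEdge G u₁ v₁) u₂ v₂

  G⊑G′ : G ⊑ G′
  G⊑G′ = ⊑-addEdge₂

  via : (K : Graph _) → V K ⊆ V G → α G ≤ α K → G′ ⊑ K → α G ≤ α G′
  via K VK⊆VG αG≤αK G′⊑K = ≤-trans αG≤αK (α-antitone VK⊆VG G′⊑K)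

  lower : NonEdge G u₁ v₁ ⊎ Adjacent G u₁ v₁ → NonEdge G u₂ v₂ ⊎ Adjacent G u₂ v₂ → α G ≤ α G′
  lower (inj₁ ne₁) (inj₁ ne₂) = ≤-reflexive (sym (stG u₁ v₁ u₂ v₂ ne₁ ne₂))
  lower (inj₁ ne₁) (inj₂ a₂)  = via (addEdge G u₁ v₁) id (α≤α-addEdge {G = G} stG ne₁)
    (addEdge-least ⊑-refl (Adjacent-mono ⊑-addEdge a₂))
  lower (inj₂ a₁)  (inj₁ ne₂) = via (addEdge G u₂ v₂) id (α≤α-addEdge {G = G} stG ne₂)
    (addEdge-mono (addEdge-least ⊑-refl a₁))
  lower (inj₂ a₁)  (inj₂ a₂)  = via G id ≤-refl (addEdge-least (addEdge-least ⊑-refl a₁) a₂)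

∣p∣≡∣p∩q∣+∣p∩∁q∣ : (p q : Subset n) → ∣ p ∣ ≡ ∣ p ∩ q ∣ + ∣ p ∩ ∁ q ∣
∣p∣≡∣p∩q∣+∣p∩∁q∣ []            []            = refl
∣p∣≡∣p∩q∣+∣p∩∁q∣ (outside ∷ p) (_ ∷ q)       = ∣p∣≡∣p∩q∣+∣p∩∁q∣ p q
∣p∣≡∣p∩q∣+∣p∩∁q∣ (inside ∷ p)  (inside ∷ q)  = cong suc (∣p∣≡∣p∩q∣+∣p∩∁q∣ p q)
∣p∣≡∣p∩q∣+∣p∩∁q∣ (inside ∷ p)  (outside ∷ q) =
  trans (cong suc (∣p∣≡∣p∩q∣+∣p∩∁q∣ p q)) (sym (+-suc _ _))

subgraph⇒⊑ : Subgraph H G → H ⊑ G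
subgraph⇒⊑ sg = mk⊑ (Subgraph.esub sg _ _)

addEdge-subgraph : Subgraph H G → Subgraph (addEdge H u v) (addEdge G u v)
addEdge-subgraph sg = record
  { vsub = Subgraph.vsub sg
  ; esub = λ _ _ → addEdge-mono (subgraph⇒⊑ sg) .adj-mono
  }

minus-⊑ : G minus H ⊑ G
minus-⊑ = mk⊑ (∧-conicalˡ _ _)

∈-minus : u ∈ V G → u ∉ V H → u ∈ V (G minus H)
∈-minus {u = u} {G = G} {H = H} u∈VG u∉VH = ∈⇔lookup≡true .from
  (trans (lookup-zipWith _ u (V G) (V H))
         (∧≡true⇔ .from (∈⇔lookup≡true .to u∈VG , cong not (¬-not (u∉VH ∘ ∈⇔lookup≡true .from)))))

minus-monoˡ : V G ≡ V K → G ⊑ K → G minus H ⊑ K minus H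
minus-monoˡ {G = graph VG a} {K = graph VG b} refl G⊑K = mk⊑ λ {u} {v} uv →
  ∧≡true⇔ .from (G⊑K .adj-mono (∧-conicalˡ (a u v) _ uv) , proj₂ (∧≡true⇔ {a u v} .to uv))

α-subadditive : Subgraph H G → α G ≤ α H + α (G minus H)
α-subadditive {H = H} {G = G} sg = α-lub λ S st → begin
  ∣ S ∣                          ≡⟨ ∣p∣≡∣p∩q∣+∣p∩∁q∣ S (V H) ⟩
  ∣ S ∩ V H ∣ + ∣ S ∩ ∁ (V H) ∣  ≤⟨ +-mono-≤ (stable⇒∣S∣≤α (inside-H st)) (stable⇒∣S∣≤α (outside-H st)) ⟩
  α H + α (G minus H)            ∎
  where
  open ≤-Reasoning

  inside-H : IsStableSet G S → IsStableSet H (S ∩ V H)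
  inside-H {S} st =
    stable-restrict (subgraph⇒⊑ sg) st (proj₁ ∘ x∈p∩q⁻ S (V H)) (proj₂ ∘ x∈p∩q⁻ S (V H))

  outside-H : IsStableSet G S → IsStableSet (G minus H) (S ∩ ∁ (V H))
  outside-H {S} st = stable-restrict (minus-⊑ {H = H}) st (proj₁ ∘ x∈p∩q⁻ S _) λ u∈S∖VH →
    let u∈S , u∈∁VH = x∈p∩q⁻ S _ u∈S∖VH
    in ∈-minus {G = G} {H = H} (st .⊆V u∈S) (x∈∁p⇒x∉p u∈∁VH)

lemma3 : ∀ {n} (G H : Graph n) → Simple G → Simple H → Subgraph H G →
    α G ≡ α H + α (G minus H) → α⁺⁺-stable G → α⁺⁺-stable H
lemma3 G H sG _ sg α-splits stG u₁ v₁ u₂ v₂ ne₁ ne₂ = ≤-antisym (α-antitone id H⊑H′) αH≤αH′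
  where
  H′ = addEdge (addEdge H u₁ v₁) u₂ v₂
  G′ = addEdge (addEdge G u₁ v₁) u₂ v₂

  H⊑H′ : H ⊑ H′
  H⊑H′ = ⊑-addEdge₂

  G⊑G′ : G ⊑ G′
  G⊑G′ = ⊑-addEdge₂

  G-H⊑G′-H′ : G minus H ⊑ G′ minus H′
  G-H⊑G′-H′ = minus-monoˡ {H = H} refl G⊑G′

  αH≤αH′ : α H ≤ α H′
  αH≤αH′ = +-cancelʳ-≤ (α (G minus H)) (α H) (α H′) $ begin
    α H + α (G minus H)     ≡⟨ α-splits ⟨
    α G                     ≡⟨ α⁺⁺-stable-vertexPairs sG stG (nonEdge⇒vertexPair sg ne₁)
                                                              (nonEdge⇒vertexPair sg ne₂) ⟨
    α G′                    ≤⟨ α-subadditive (addEdge-subgraph (addEdge-subgraph sg)) ⟩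
    α H′ + α (G′ minus H′)  ≤⟨ +-monoʳ-≤ (α H′) (α-antitone id G-H⊑G′-H′) ⟩
    α H′ + α (G minus H)    ∎
    where open ≤-Reasoning
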